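{- Let $\mathcal V$ be a variety of signature $\mathcal F$, $s,t\in T_{\mathcal F}(n)$, and $\psi:\{x_1,\ldots,x_n\}\to T_{\mathcal F}(n)$ a substitution, with $\boldsymbol\psi$ the endomorphism of $\mathbf F_n$ given by $\boldsymbol\psi(\mathbf x_i)=\mathbf p_i$ where $\psi(x_i)=p_i$. The following are equivalent: (1) $\boldsymbol\psi$ is a $\mathcal V$-projective unifier for $(s,t)$; (2) for every $\mathbf A\in\mathcal V$ and every $\underline a=(a_1,\ldots,a_n)\in A^n$: (a) $s^{\mathbf A}(\psi(\underline a))=t^{\mathbf A}(\psi(\underline a))$, and (b) $s^{\mathbf A}(\underline a)=t^{\mathbf A}(\underline a)$ implies $\psi(\underline a)=\underline a$; where $\psi(\underline a)\in A^n$ has $i$-th coordinate $(\psi(x_i))^{\mathbf A}(\underline a)$; (3) $\mathcal V\models\psi(s)\approx\psi(t)$ and $\mathcal V\models s\approx t\rightarrow\bigwedge_{i=1}^n(\psi(x_i)\approx x_i)$.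
   Context: $T_{\mathcal F}(n)$ is the term algebra in $x_1,\dots,x_n$; $\mathbf F_n$ the free algebra of $\mathcal V$ on $\mathbf x_1,\dots,\mathbf x_n$; $\mathbf t$ the class of $t$; $t^{\mathbf A}$ the term operation on $\mathbf A$; $\psi(s)$ the result of applying the substitution to $s$. An endomorphism $\tau$ of $\mathbf F_n$ is a $\mathcal V$-projective unifier for $(s,t)$ if $\tau(\mathbf s)=\tau(\mathbf t)$ and $(\tau(\mathbf x_i),\mathbf x_i)\in\Theta(\mathbf s,\mathbf t)$ for all $i$, where $\Theta(\mathbf s,\mathbf t)$ is the congruence of $\mathbf F_n$ generated by $(\mathbf s,\mathbf t)$. The second condition in (3) is a quasi-identity holding in $\mathcal V$. -}

module Defs where

open import Data.Nat using (ℕ)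
open import Data.Fin using (Fin)
open import Relation.Binary.Structures using (IsEquivalence)

record Signature : Set₁ where
  field
    Op    : Set
    arity : Op → ℕ
open Signature public

module _ (𝓕 : Signature) where

  data Term (n : ℕ) : Set where
    var : Fin n → Term n
    op  : (f : Op 𝓕) → (Fin (arity 𝓕 f) → Term n) → Term n

  record Algebra : Set₁ where
    field
      Carrier : Set
      _≈_     : Carrier → Carrier → Set
      isEquiv : IsEquivalence _≈_
      ⟦_⟧     : (f : Op 𝓕) → (Fin (arity 𝓕 f) → Carrier) → Carrier
      ⟦⟧-cong : ∀ f {as bs : Fin (arity 𝓕 f) → Carrier} →
                (∀ i → as i ≈ bs i) → ⟦ f ⟧ as ≈ ⟦ f ⟧ bs
  open Algebra public

  eval : (A : Algebra) {n : ℕ} → Term n → (Fin n → Carrier A) → Carrier A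
  eval A (var i)   a = a i
  eval A (op f ts) a = ⟦ A ⟧ f (λ i → eval A (ts i) a)

  Subst : ℕ → ℕ → Set
  Subst n m = Fin n → Term m

  subst : {n m : ℕ} → Subst n m → Term n → Term m
  subst σ (var i)   = σ i
  subst σ (op f ts) = op f (λ i → subst σ (ts i))

  -- A variety, presented (Birkhoff) by a class of identities; its members
  -- are the algebras satisfying all of them.
  record Variety : Set₁ where
    field
      Ids : (m : ℕ) → Term m → Term m → Set

  _∈_ : Algebra → Variety → Set
  A ∈ V = ∀ m (u v : Term m) → Variety.Ids V m u v →
          ∀ (a : Fin m → Carrier A) → _≈_ A (eval A u a) (eval A v a)

  _⊨_≈_ : Variety → {n : ℕ} → Term n → Term n → Set₁
  V ⊨ u ≈ v = ∀ (A : Algebra) → A ∈ V →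
              ∀ a → _≈_ A (eval A u a) (eval A v a)

  -- Free algebra 𝐅ₙ of 𝓥: T_𝓕(n) with equality 𝐮 = 𝐯 iff 𝓥 ⊨ u ≈ v.
  -- Congruence Θ(𝐬,𝐭) of 𝐅ₙ generated by (𝐬,𝐭), given as a relation
  -- on representatives (it contains the kernel of T_𝓕(n) → 𝐅ₙ).
  data Θ (V : Variety) {n : ℕ} (s t : Term n) : Term n → Term n → Set₁ where
    gen    : Θ V s t s t
    free   : ∀ {u v} → V ⊨ u ≈ v → Θ V s t u v
    θsym   : ∀ {u v} → Θ V s t u v → Θ V s t v u
    θtrans : ∀ {u v w} → Θ V s t u v → Θ V s t v w → Θ V s t u w
    θcong  : ∀ f {us vs : Fin (arity 𝓕 f) → Term n} →
             (∀ i → Θ V s t (us i) (vs i)) → Θ V s t (op f us) (op f vs)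

  -- The endomorphism 𝛙 of 𝐅ₙ induced by ψ maps 𝐮 to the class of ψ(u).
  -- 𝛙 is a 𝓥-projective unifier for (s,t).
  IsProjectiveUnifier : (V : Variety) {n : ℕ} → Subst n n → Term n → Term n → Set₁
  IsProjectiveUnifier V {n} ψ s t =
    (V ⊨ subst ψ s ≈ subst ψ t) × (∀ (i : Fin n) → Θ V s t (ψ i) (var i))
    where open import Data.Product using (_×_)

  applyTuple : (A : Algebra) {n : ℕ} → Subst n n → (Fin n → Carrier A) → Fin n → Carrier A
  applyTuple A ψ a i = eval A (ψ i) a

-- By the substitution lemma, 𝓥 ⊨ ψ(s) ≈ ψ(t) says that s and t agree at every
-- tuple ψ(a); and (u, v) ∈ Θ(𝐬,𝐭) iff the quasi-identity s ≈ t → u ≈ v holds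
-- in 𝓥. That quasi-identity is sound for Θ by induction on derivations, and it
-- yields (u, v) ∈ Θ(𝐬,𝐭) when evaluated in 𝐅ₙ/Θ(𝐬,𝐭) at the generic tuple of
-- variables, where s ≈ t holds by construction.
module Submission where

open import Defs
open import Data.Nat using (ℕ)
open import Data.Fin using (Fin)
open import Data.Product using (_×_; _,_; proj₁; proj₂)
open import Data.Product.Function.NonDependent.Propositional using (_×-⇔_)
open import Function.Bundles using (_⇔_; mk⇔; Equivalence)
open import Function.Construct.Composition using (_⇔-∘_)
open import Function.Construct.Identity using (⇔-id)
open import Function.Construct.Symmetry using (⇔-sym)
open import Relation.Binary.Structures using (IsEquivalence)

module _ {𝓕 : Signature} where

  private
    module ≈ (A : Algebra 𝓕) = IsEquivalence (isEquiv A)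

  eval-subst : (A : Algebra 𝓕) {m n : ℕ} (σ : Subst 𝓕 m n) (u : Term 𝓕 m)
               (a : Fin n → Carrier A) →
               _≈_ A (eval 𝓕 A (subst 𝓕 σ u) a) (eval 𝓕 A u (λ j → eval 𝓕 A (σ j) a))
  eval-subst A σ (var i)   a = ≈.refl A
  eval-subst A σ (op f us) a = ⟦⟧-cong A f (λ i → eval-subst A σ (us i) a)

  _⊨_≈_⇒_≈_ : Variety 𝓕 → {n : ℕ} → Term 𝓕 n → Term 𝓕 n → Term 𝓕 n → Term 𝓕 n → Set₁
  V ⊨ s ≈ t ⇒ u ≈ v = ∀ (A : Algebra 𝓕) → _∈_ 𝓕 A V → ∀ a →
                      _≈_ A (eval 𝓕 A s a) (eval 𝓕 A t a) →
                      _≈_ A (eval 𝓕 A u a) (eval 𝓕 A v a)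

  _⊨_≈_⇒⋀_≈_ : Variety 𝓕 → {n : ℕ} {I : Set} → Term 𝓕 n → Term 𝓕 n →
               (I → Term 𝓕 n) → (I → Term 𝓕 n) → Set₁
  V ⊨ s ≈ t ⇒⋀ us ≈ vs = ∀ (A : Algebra 𝓕) → _∈_ 𝓕 A V → ∀ a →
                         _≈_ A (eval 𝓕 A s a) (eval 𝓕 A t a) →
                         ∀ i → _≈_ A (eval 𝓕 A (us i) a) (eval 𝓕 A (vs i) a)

  module _ (V : Variety 𝓕) where

    ⊨-subst⇔ : {m n : ℕ} (σ : Subst 𝓕 m n) (u v : Term 𝓕 m) →
               _⊨_≈_ 𝓕 V (subst 𝓕 σ u) (subst 𝓕 σ v) ⇔
               (∀ (A : Algebra 𝓕) → _∈_ 𝓕 A V → ∀ a →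
                  _≈_ A (eval 𝓕 A u (λ j → eval 𝓕 A (σ j) a))
                        (eval 𝓕 A v (λ j → eval 𝓕 A (σ j) a)))
    ⊨-subst⇔ σ u v = mk⇔
      (λ σu≈σv A A∈V a → ≈.trans A (≈.sym A (eval-subst A σ u a))
                           (≈.trans A (σu≈σv A A∈V a) (eval-subst A σ v a)))
      (λ u≈v A A∈V a → ≈.trans A (eval-subst A σ u a)
                         (≈.trans A (u≈v A A∈V a) (≈.sym A (eval-subst A σ v a))))

    Θ-sound : {n : ℕ} {s t u v : Term 𝓕 n} → Θ 𝓕 V s t u v → V ⊨ s ≈ t ⇒ u ≈ v
    Θ-sound gen          A A∈V a s≈t = s≈t
    Θ-sound (free u≈v)   A A∈V a s≈t = u≈v A A∈V a
    Θ-sound (θsym p)     A A∈V a s≈t = ≈.sym A (Θ-sound p A A∈V a s≈t)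
    Θ-sound (θtrans p q) A A∈V a s≈t =
      ≈.trans A (Θ-sound p A A∈V a s≈t) (Θ-sound q A A∈V a s≈t)
    Θ-sound (θcong f ps) A A∈V a s≈t = ⟦⟧-cong A f (λ i → Θ-sound (ps i) A A∈V a s≈t)

    -- _∼_ is the least congruence of T_𝓕(n) containing (s, t) and the
    -- identities of 𝓥, so T_𝓕(n)/∼ is 𝐅ₙ/Θ(𝐬,𝐭).
    module Presentation {n : ℕ} (s t : Term 𝓕 n) where

      infix 4 _∼_
      data _∼_ : Term 𝓕 n → Term 𝓕 n → Set where
        s∼t     : s ∼ t
        axiom   : ∀ {m u v} → Variety.Ids V m u v → (σ : Subst 𝓕 m n) →
                  subst 𝓕 σ u ∼ subst 𝓕 σ v
        ∼-refl  : ∀ {u} → u ∼ u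
        ∼-sym   : ∀ {u v} → u ∼ v → v ∼ u
        ∼-trans : ∀ {u v w} → u ∼ v → v ∼ w → u ∼ w
        ∼-cong  : ∀ f {us vs : Fin (arity 𝓕 f) → Term 𝓕 n} →
                  (∀ i → us i ∼ vs i) → op f us ∼ op f vs

      ∼⇒Θ : ∀ {u v} → u ∼ v → Θ 𝓕 V s t u v
      ∼⇒Θ s∼t           = gen
      ∼⇒Θ ∼-refl        = free (λ A A∈V a → ≈.refl A)
      ∼⇒Θ (∼-sym p)     = θsym (∼⇒Θ p)
      ∼⇒Θ (∼-trans p q) = θtrans (∼⇒Θ p) (∼⇒Θ q)
      ∼⇒Θ (∼-cong f ps) = θcong f (λ i → ∼⇒Θ (ps i))
      ∼⇒Θ (axiom {m} {u} {v} u≈v σ) =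
        free (Equivalence.from (⊨-subst⇔ σ u v) (λ A A∈V a → A∈V m u v u≈v _))

      𝐅/Θ : Algebra 𝓕
      𝐅/Θ = record
        { Carrier = Term 𝓕 n
        ; _≈_     = _∼_
        ; isEquiv = record { refl = ∼-refl ; sym = ∼-sym ; trans = ∼-trans }
        ; ⟦_⟧     = op
        ; ⟦⟧-cong = ∼-cong
        }

      eval-𝐅/Θ : {m : ℕ} (u : Term 𝓕 m) (σ : Subst 𝓕 m n) → eval 𝓕 𝐅/Θ u σ ∼ subst 𝓕 σ u
      eval-𝐅/Θ (var i)   σ = ∼-refl
      eval-𝐅/Θ (op f us) σ = ∼-cong f (λ i → eval-𝐅/Θ (us i) σ)

      eval-𝐅/Θ-var : (u : Term 𝓕 n) → eval 𝓕 𝐅/Θ u var ∼ u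
      eval-𝐅/Θ-var (var i)   = ∼-refl
      eval-𝐅/Θ-var (op f us) = ∼-cong f (λ i → eval-𝐅/Θ-var (us i))

      𝐅/Θ∈V : _∈_ 𝓕 𝐅/Θ V
      𝐅/Θ∈V m u v u≈v σ = ∼-trans (eval-𝐅/Θ u σ) (∼-trans (axiom u≈v σ) (∼-sym (eval-𝐅/Θ v σ)))

    Θ-complete : {n : ℕ} {s t u v : Term 𝓕 n} → V ⊨ s ≈ t ⇒ u ≈ v → Θ 𝓕 V s t u v
    Θ-complete {s = s} {t} {u} {v} s≈t⇒u≈v =
      ∼⇒Θ (∼-trans (∼-sym (eval-𝐅/Θ-var u))
            (∼-trans (s≈t⇒u≈v 𝐅/Θ 𝐅/Θ∈V var generic-s≈t) (eval-𝐅/Θ-var v)))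
      where
        open Presentation s t
        generic-s≈t : eval 𝓕 𝐅/Θ s var ∼ eval 𝓕 𝐅/Θ t var
        generic-s≈t = ∼-trans (eval-𝐅/Θ-var s) (∼-trans s∼t (∼-sym (eval-𝐅/Θ-var t)))

    Θ-all⇔quasiIdentity : {n : ℕ} {I : Set} {s t : Term 𝓕 n} (us vs : I → Term 𝓕 n) →
                          (∀ i → Θ 𝓕 V s t (us i) (vs i)) ⇔ V ⊨ s ≈ t ⇒⋀ us ≈ vs
    Θ-all⇔quasiIdentity us vs = mk⇔
      (λ Θuv A A∈V a s≈t i → Θ-sound (Θuv i) A A∈V a s≈t)
      (λ s≈t⇒u≈v i → Θ-complete (λ A A∈V a s≈t → s≈t⇒u≈v A A∈V a s≈t i))

    ∀∈V-distrib-× : {n : ℕ} {P Q : (A : Algebra 𝓕) → (Fin n → Carrier A) → Set} →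
      (∀ (A : Algebra 𝓕) → _∈_ 𝓕 A V → ∀ a → P A a × Q A a) ⇔
      ((∀ (A : Algebra 𝓕) → _∈_ 𝓕 A V → ∀ a → P A a) ×
       (∀ (A : Algebra 𝓕) → _∈_ 𝓕 A V → ∀ a → Q A a))
    ∀∈V-distrib-× = mk⇔
      (λ PQ → (λ A A∈V a → proj₁ (PQ A A∈V a)) , (λ A A∈V a → proj₂ (PQ A A∈V a)))
      (λ (P , Q) A A∈V a → P A A∈V a , Q A A∈V a)

    module _ {n : ℕ} (s t : Term 𝓕 n) (ψ : Subst 𝓕 n n) where

      isProjectiveUnifier⇔identity×quasiIdentity :
        IsProjectiveUnifier 𝓕 V ψ s t ⇔
        (_⊨_≈_ 𝓕 V (subst 𝓕 ψ s) (subst 𝓕 ψ t) × V ⊨ s ≈ t ⇒⋀ ψ ≈ var)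
      isProjectiveUnifier⇔identity×quasiIdentity = ⇔-id _ ×-⇔ Θ-all⇔quasiIdentity ψ var

      unifierInModels⇔identity×quasiIdentity :
        (∀ (A : Algebra 𝓕) → _∈_ 𝓕 A V → ∀ a →
           _≈_ A (eval 𝓕 A s (applyTuple 𝓕 A ψ a)) (eval 𝓕 A t (applyTuple 𝓕 A ψ a)) ×
           (_≈_ A (eval 𝓕 A s a) (eval 𝓕 A t a) → ∀ i → _≈_ A (applyTuple 𝓕 A ψ a i) (a i))) ⇔
        (_⊨_≈_ 𝓕 V (subst 𝓕 ψ s) (subst 𝓕 ψ t) × V ⊨ s ≈ t ⇒⋀ ψ ≈ var)
      unifierInModels⇔identity×quasiIdentity =
        (⇔-sym (⊨-subst⇔ ψ s t) ×-⇔ ⇔-id _) ⇔-∘ ∀∈V-distrib-×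

mainTheorem17 : (𝓕 : Signature) (V : Variety 𝓕) (n : ℕ) (s t : Term 𝓕 n) (ψ : Subst 𝓕 n n) →
  let
    cond1 = IsProjectiveUnifier 𝓕 V ψ s t
    cond2 = ∀ (A : Algebra 𝓕) → _∈_ 𝓕 A V → ∀ (a : Fin n → Carrier A) →
              (_≈_ A (eval 𝓕 A s (applyTuple 𝓕 A ψ a)) (eval 𝓕 A t (applyTuple 𝓕 A ψ a)))
              × (_≈_ A (eval 𝓕 A s a) (eval 𝓕 A t a) → ∀ i → _≈_ A (applyTuple 𝓕 A ψ a i) (a i))
    cond3 = (_⊨_≈_ 𝓕 V (subst 𝓕 ψ s) (subst 𝓕 ψ t))
            × (∀ (A : Algebra 𝓕) → _∈_ 𝓕 A V → ∀ (a : Fin n → Carrier A) →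
                 _≈_ A (eval 𝓕 A s a) (eval 𝓕 A t a) → ∀ i → _≈_ A (eval 𝓕 A (ψ i) a) (a i))
  in (cond1 ⇔ cond2) × (cond2 ⇔ cond3)
mainTheorem17 𝓕 V n s t ψ =
  ⇔-sym (unifierInModels⇔identity×quasiIdentity V s t ψ) ⇔-∘
    isProjectiveUnifier⇔identity×quasiIdentity V s t ψ ,
  unifierInModels⇔identity×quasiIdentity V s t ψ
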